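{- For every integer $e\ge 3$ there exists a strongly equitable $2$-chromatic $e$-star system of order $2e$, i.e. a $2$-chromatic $e$-star system of order $2e$ admitting a $2$-colouring whose two colour classes each have exactly $e$ vertices.
   Context: An $e$-star is the complete bipartite graph $K_{1,e}$. An $e$-star system of order $n$ is a pair $(V,\mathcal B)$ where $|V|=n$ and $\mathcal B$ is a set of $e$-stars (subgraphs of the complete graph $K_n$ on $V$) whose edge sets partition the edge set of $K_n$. An $e$-star system is $k$-colourable if $V$ can be partitioned into $k$ sets (colour classes) such that no star in $\mathcal B$ has all its vertices in the same class; it is $k$-chromatic if it is $k$-colourable but not $(k-1)$-colourable. A colouring is strongly equitable if all colour classes have the same size; a system is strongly equitable $k$-chromatic if it is $k$-chromatic and admits a strongly equitable $k$-colouring. -}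

module Defs where

open import Data.Nat using (ℕ; zero; suc; _+_)
open import Data.Fin using (Fin)
open import Data.Fin.Properties using (_≟_)
open import Data.List using (List; length; map; filter; allFin)
open import Data.Nat.ListAction using (sum)
open import Data.List.Relation.Unary.All using (All)
open import Data.List.Relation.Unary.Any using (Any)
open import Data.List.Relation.Unary.Unique.Propositional using (Unique)
open import Data.Product using (_×_; _,_; Σ; ∃)
open import Data.Sum using (_⊎_)
open import Relation.Nullary using (¬_; Dec; yes; no)
open import Relation.Binary.PropositionalEquality using (_≡_; _≢_)

record Star (n : ℕ) : Set where
  constructor star
  field
    centre : Fin n
    leaves : List (Fin n)
open Star public

IsEStar : ∀ {n} → ℕ → Star n → Set
IsEStar e s = length (leaves s) ≡ e × Unique (leaves s) × All (λ l → l ≢ centre s) (leaves s)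

sameEdge? : ∀ {n} (c l u v : Fin n) → Dec ((c ≡ u × l ≡ v) ⊎ (c ≡ v × l ≡ u))
sameEdge? c l u v with c ≟ u | l ≟ v | c ≟ v | l ≟ u
... | yes p | yes q | _ | _ = yes (_⊎_.inj₁ (p , q))
... | _ | _ | yes p | yes q = yes (_⊎_.inj₂ (p , q))
... | no p | _ | no r | _ = no λ { (_⊎_.inj₁ (a , _)) → p a ; (_⊎_.inj₂ (a , _)) → r a }
... | no p | _ | yes r | no s = no λ { (_⊎_.inj₁ (a , _)) → p a ; (_⊎_.inj₂ (_ , b)) → s b }
... | yes p | no q | no r | _ = no λ { (_⊎_.inj₁ (_ , b)) → q b ; (_⊎_.inj₂ (a , _)) → r a }
... | yes p | no q | yes r | no s = no λ { (_⊎_.inj₁ (_ , b)) → q b ; (_⊎_.inj₂ (_ , b)) → s b }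

edgeCount : ∀ {n} → Star n → Fin n → Fin n → ℕ
edgeCount s u v = length (filter (λ l → sameEdge? (centre s) l u v) (leaves s))

coverCount : ∀ {n} → List (Star n) → Fin n → Fin n → ℕ
coverCount B u v = sum (map (λ s → edgeCount s u v) B)

-- (Fin n, B) is an e-star system of order n: every block is an e-star and the
-- edge sets of the blocks partition E(K_n), i.e. every edge {u,v} (u ≠ v)
-- lies in exactly one block, exactly once.
IsStarSystem : (e n : ℕ) → List (Star n) → Set
IsStarSystem e n B = All (IsEStar e) B × (∀ (u v : Fin n) → u ≢ v → coverCount B u v ≡ 1)

Monochromatic : ∀ {n k} → (Fin n → Fin k) → Star n → Set
Monochromatic col s = All (λ l → col l ≡ col (centre s)) (leaves s)

ProperColouring : ∀ {n k} → List (Star n) → (Fin n → Fin k) → Set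
ProperColouring B col = All (λ s → ¬ Monochromatic col s) B

Colourable : ∀ {n} → ℕ → List (Star n) → Set
Colourable {n} k B = Σ (Fin n → Fin k) (ProperColouring B)

Chromatic : ∀ {n} → ℕ → List (Star n) → Set
Chromatic k B = Colourable k B × (∀ j → suc j ≡ k → ¬ Colourable j B)

classSize : ∀ {n k} → (Fin n → Fin k) → Fin k → ℕ
classSize {n} col i = length (filter (λ v → col v ≟ i) (allFin n))

module Submission where

-- Take the rotational regular tournament on 2e−1 vertices (i beats i+1, …, i+e−1 modulo 2e−1)
-- and add one vertex beaten by all of them. Every old vertex then has out-degree e, so the
-- out-stars of the old vertices are 2e−1 e-stars, and since every edge of K_{2e} is oriented
-- exactly one way they partition its edges. Colour the first e vertices 0 and the last e
-- vertices 1: a centre of colour 0 beats the new vertex 2e−1 and a centre of colour 1 beats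
-- vertex 0, so no star is monochromatic, while with one colour every star is.

open import Data.Nat using (ℕ; zero; suc; _+_; _≤_; _<_; z≤n; s≤s; z<s; _≟_; _<?_; _≤?_)
open import Data.Nat.Properties
open import Data.Nat.ListAction using (sum)
open import Data.Nat.Tactic.RingSolver using (solve)
open import Data.Fin as Fin using (Fin; toℕ; fromℕ)
open import Data.Fin.Properties using (toℕ-fromℕ; toℕ<n; toℕ-injective) renaming (_≟_ to _≟ᶠ_; 0≢1+n to zero≢suc)
open import Data.List using (List; []; _∷_; length; map; filter; allFin; tabulate)
open import Data.List.Properties using (map-∘; map-cong; filter-none; filter-≐)
open import Data.List.Relation.Unary.All as All using (All)
import Data.List.Relation.Unary.All.Properties as All
open import Data.List.Relation.Unary.Any using (here; there)
open import Data.List.Relation.Unary.AllPairs using (_∷_)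
open import Data.List.Relation.Unary.Unique.Propositional using (Unique)
import Data.List.Relation.Unary.Unique.Propositional.Properties as Unique
open import Data.List.Membership.Propositional using (_∈_)
open import Data.List.Membership.Propositional.Properties using (∈-filter⁺; ∈-filter⁻; ∈-allFin; ∈-map⁺; ∈-map⁻)
open import Data.Product using (Σ; _×_; _,_; proj₁; proj₂)
open import Data.Sum as Sum using (_⊎_; inj₁; inj₂; swap)
open import Data.Empty using (⊥-elim)
open import Function using (_∘_)
open import Relation.Nullary using (¬_; Dec; yes; no)
open import Relation.Nullary.Decidable using (_×-dec_; _⊎-dec_)
open import Relation.Unary using (Decidable)
open import Relation.Binary.Definitions using (tri<; tri≈; tri>)
open import Relation.Binary.PropositionalEquality
open import Defs

module _ {A : Set} {P : A → Set} (P? : Decidable P) where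

  length-filter-unique : ∀ {xs w} → Unique xs → w ∈ xs → P w → (∀ {x} → P x → x ≡ w) →
                         length (filter P? xs) ≡ 1
  length-filter-unique {x ∷ xs} (x∉xs ∷ _) (here refl) Pw only with P? x
  ... | no ¬Px = ⊥-elim (¬Px Pw)
  ... | yes _ = cong (suc ∘ length) (filter-none P? (All.map (λ x≢y Py → x≢y (sym (only Py))) x∉xs))
  length-filter-unique {x ∷ xs} (x∉xs ∷ xs!) (there w∈xs) Pw only with P? x
  ... | yes Px = ⊥-elim (All.lookup x∉xs w∈xs (only Px))
  ... | no _ = length-filter-unique xs! w∈xs Pw only

module _ {A : Set} (f : A → ℕ) where

  sum-map-zero : ∀ {xs} → (∀ {x} → x ∈ xs → f x ≡ 0) → sum (map f xs) ≡ 0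
  sum-map-zero {[]} _ = refl
  sum-map-zero {x ∷ xs} f≡0 rewrite f≡0 (here refl) = sum-map-zero (f≡0 ∘ there)

  sum-map-unique : ∀ {xs w} → Unique xs → w ∈ xs → f w ≡ 1 →
                   (∀ {x} → x ∈ xs → x ≢ w → f x ≡ 0) → sum (map f xs) ≡ 1
  sum-map-unique {x ∷ xs} (x∉xs ∷ _) (here refl) fw≡1 others rewrite fw≡1 =
    cong suc (sum-map-zero λ y∈xs → others (there y∈xs) λ { refl → All.lookup x∉xs y∈xs refl })
  sum-map-unique {x ∷ xs} (x∉xs ∷ xs!) (there w∈xs) fw≡1 others
    rewrite others (here refl) (All.lookup x∉xs w∈xs) = sum-map-unique xs! w∈xs fw≡1 (others ∘ there)

module _ {P : ℕ → Set} (P? : Decidable P) where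

  count : ℕ → ℕ → ℕ
  count k zero = 0
  count k (suc n) with P? k
  ... | yes _ = suc (count (suc k) n)
  ... | no _ = count (suc k) n

  count-+ : ∀ k a b → count k (a + b) ≡ count k a + count (k + a) b
  count-+ k zero b rewrite +-identityʳ k = refl
  count-+ k (suc a) b rewrite +-suc k a with P? k
  ... | yes _ = cong suc (count-+ (suc k) a b)
  ... | no _ = count-+ (suc k) a b

  count-all : ∀ k n → (∀ {j} → k ≤ j → j < k + n → P j) → count k n ≡ n
  count-all k zero _ = refl
  count-all k (suc n) all with P? k
  ... | no ¬Pk = ⊥-elim (¬Pk (all ≤-refl (m<m+n k z<s)))
  ... | yes _ = cong suc (count-all (suc k) n λ {j} k<j j<k+1+n → all (<⇒≤ k<j) (subst (j <_) (sym (+-suc k n)) j<k+1+n))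

  count-none : ∀ k n → (∀ {j} → k ≤ j → j < k + n → ¬ P j) → count k n ≡ 0
  count-none k zero _ = refl
  count-none k (suc n) none with P? k
  ... | yes Pk = ⊥-elim (none ≤-refl (m<m+n k z<s) Pk)
  ... | no _ = count-none (suc k) n λ {j} k<j j<k+1+n → none (<⇒≤ k<j) (subst (j <_) (sym (+-suc k n)) j<k+1+n)

  count-one : ∀ {k} → P k → count k 1 ≡ 1
  count-one {k} Pk with P? k
  ... | yes _ = refl
  ... | no ¬Pk = ⊥-elim (¬Pk Pk)

  count-split₄ : ∀ a b c d → count 0 (a + b + c + d) ≡ count 0 a + count a b + count (a + b) c + count (a + b + c) d
  count-split₄ a b c d rewrite count-+ 0 (a + b + c) d | count-+ 0 (a + b) c | count-+ 0 a b = refl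

  length-filter-tabulate : ∀ {N} n k (g : Fin n → Fin N) → (∀ i → toℕ (g i) ≡ k + toℕ i) →
                           length (filter (P? ∘ toℕ) (tabulate g)) ≡ count k n
  length-filter-tabulate zero k g _ = refl
  length-filter-tabulate (suc n) k g g≡
    with ih ← length-filter-tabulate n (suc k) (g ∘ Fin.suc) (λ i → trans (g≡ (Fin.suc i)) (+-suc k _))
       | g0≡k ← trans (g≡ Fin.zero) (+-identityʳ k)
       | P? (toℕ (g Fin.zero)) | P? k
  ... | yes _ | yes _ = cong suc ih
  ... | no _ | no _ = ih
  ... | yes Pg0 | no ¬Pk = ⊥-elim (¬Pk (subst P g0≡k Pg0))
  ... | no ¬Pg0 | yes Pk = ⊥-elim (¬Pg0 (subst P (sym g0≡k) Pk))

  length-filter-allFin : ∀ n → length (filter (P? ∘ toℕ) (allFin n)) ≡ count 0 n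
  length-filter-allFin n = length-filter-tabulate n 0 (λ i → i) (λ _ → refl)

edgeCount-sym : ∀ {n} (s : Star n) u v → edgeCount s u v ≡ edgeCount s v u
edgeCount-sym s u v =
  cong length (filter-≐ (λ l → sameEdge? (centre s) l u v) (λ l → sameEdge? (centre s) l v u) (swap , swap) (leaves s))

colourable-2⇒chromatic-2 : ∀ {n} {B : List (Star n)} {s} → s ∈ B → Colourable 2 B → Chromatic 2 B
colourable-2⇒chromatic-2 s∈B colourable =
  colourable , λ { .1 refl (col , proper) → All.lookup proper s∈B (All.tabulate λ _ → Fin1-unique _ _) }
  where
  Fin1-unique : (a b : Fin 1) → a ≡ b
  Fin1-unique Fin.zero Fin.zero = refl

module Orientation {n : ℕ} {Out : Fin n → Fin n → Set} (Out? : ∀ u v → Dec (Out u v))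
                   (asym : ∀ {u v} → Out u v → ¬ Out v u) where

  outNeighbours : Fin n → List (Fin n)
  outNeighbours u = filter (Out? u) (allFin n)

  outStar : Fin n → Star n
  outStar u = star u (outNeighbours u)

  outNeighbours-unique : ∀ u → Unique (outNeighbours u)
  outNeighbours-unique u = Unique.filter⁺ (Out? u) (Unique.allFin⁺ n)

  ∈-outNeighbours⁺ : ∀ {u v} → Out u v → v ∈ outNeighbours u
  ∈-outNeighbours⁺ = ∈-filter⁺ (Out? _) (∈-allFin _)

  ∈-outNeighbours⁻ : ∀ {u v} → v ∈ outNeighbours u → Out u v
  ∈-outNeighbours⁻ {u} = proj₂ ∘ ∈-filter⁻ (Out? u) {xs = allFin n}

  outStar-isEStar : ∀ {e} u → length (outNeighbours u) ≡ e → IsEStar e (outStar u)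
  outStar-isEStar u deg =
    deg , outNeighbours-unique u , All.tabulate λ { v∈ refl → let uu = ∈-outNeighbours⁻ v∈ in asym uu uu }

  edgeCount-outStar-tail : ∀ {u v} → Out u v → edgeCount (outStar u) u v ≡ 1
  edgeCount-outStar-tail {u} {v} uv = length-filter-unique (λ l → sameEdge? u l u v)
    (outNeighbours-unique u) (∈-outNeighbours⁺ uv) (inj₁ (refl , refl)) λ where
      (inj₁ (_ , l≡v)) → l≡v
      (inj₂ (refl , _)) → ⊥-elim (asym uv uv)

  edgeCount-outStar-other : ∀ {c u v} → Out u v → c ≢ u → edgeCount (outStar c) u v ≡ 0
  edgeCount-outStar-other {c} {u} {v} uv c≢u =
    cong length (filter-none (λ l → sameEdge? c l u v) {xs = outNeighbours c} (All.tabulate λ where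
      l∈ (inj₁ (c≡u , _)) → c≢u c≡u
      l∈ (inj₂ (refl , refl)) → asym uv (∈-outNeighbours⁻ l∈)))

  module _ {cs : List (Fin n)} (cs! : Unique cs) (tails∈cs : ∀ {u v} → Out u v → u ∈ cs) where

    coverCount-outStars : ∀ {u v} → Out u v → coverCount (map outStar cs) u v ≡ 1
    coverCount-outStars {u} {v} uv = trans (cong sum (sym (map-∘ cs)))
      (sum-map-unique (λ c → edgeCount (outStar c) u v) cs! (tails∈cs uv) (edgeCount-outStar-tail uv)
        λ _ → edgeCount-outStar-other uv)

    outStars-isStarSystem : ∀ {e} → (∀ {u v} → u ≢ v → Out u v ⊎ Out v u) →
      (∀ {c} → c ∈ cs → length (outNeighbours c) ≡ e) → IsStarSystem e n (map outStar cs)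
    outStars-isStarSystem {e} total regular = All.tabulate isEStar , cover
      where
      isEStar : ∀ {s} → s ∈ map outStar cs → IsEStar e s
      isEStar s∈ with ∈-map⁻ outStar s∈
      ... | c , c∈cs , refl = outStar-isEStar c (regular c∈cs)
      cover : ∀ u v → u ≢ v → coverCount (map outStar cs) u v ≡ 1
      cover u v u≢v with total u≢v
      ... | inj₁ uv = coverCount-outStars uv
      ... | inj₂ vu =
        trans (cong sum (map-cong (λ s → edgeCount-sym s u v) (map outStar cs))) (coverCount-outStars vu)

  outStar-not-monochromatic : ∀ {k} (col : Fin n → Fin k) {u v} → Out u v → col v ≢ col u →
                              ¬ Monochromatic col (outStar u)
  outStar-not-monochromatic col uv colv≢colu mono = colv≢colu (All.lookup mono (∈-outNeighbours⁺ uv))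

-- For i, j < 2m+1, Arc m i j says that j ∈ {i+1, …, i+m} modulo 2m+1: the rotational regular
-- tournament on 2m+1 vertices. Beats adds the vertex sink m = 2m+1, beaten by all others.
Arc : ℕ → ℕ → ℕ → Set
Arc m i j = (i < j × j ≤ i + m) ⊎ j + m < i

sink : ℕ → ℕ
sink m = m + suc m

Beats : ℕ → ℕ → ℕ → Set
Beats m i j = i < sink m × (j ≡ sink m ⊎ (j < sink m × Arc m i j))

beats? : ∀ m i → Decidable (Beats m i)
beats? m i j =
  (i <? sink m) ×-dec ((j ≟ sink m) ⊎-dec ((j <? sink m) ×-dec (((i <? j) ×-dec (j ≤? i + m)) ⊎-dec (j + m <? i))))

arc-asym : ∀ {m i j} → Arc m i j → ¬ Arc m j i
arc-asym (inj₁ (i<j , _)) (inj₁ (j<i , _)) = <-asym i<j j<i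
arc-asym (inj₁ (_ , j≤i+m)) (inj₂ i+m<j) = <⇒≱ i+m<j j≤i+m
arc-asym (inj₂ j+m<i) (inj₁ (_ , i≤j+m)) = <⇒≱ j+m<i i≤j+m
arc-asym {m} {i} {j} (inj₂ j+m<i) (inj₂ i+m<j) = <-asym (≤-<-trans (m≤m+n j m) j+m<i) (≤-<-trans (m≤m+n i m) i+m<j)

arc-total : ∀ {m i j} → i ≢ j → Arc m i j ⊎ Arc m j i
arc-total {m} {i} {j} i≢j with <-cmp i j
... | tri≈ _ i≡j _ = ⊥-elim (i≢j i≡j)
... | tri< i<j _ _ with j ≤? i + m
...   | yes j≤i+m = inj₁ (inj₁ (i<j , j≤i+m))
...   | no j≰i+m = inj₂ (inj₂ (≰⇒> j≰i+m))
arc-total {m} {i} {j} i≢j | tri> _ _ j<i with i ≤? j + m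
...   | yes i≤j+m = inj₂ (inj₁ (j<i , i≤j+m))
...   | no i≰j+m = inj₁ (inj₂ (≰⇒> i≰j+m))

beats-asym : ∀ {m i j} → Beats m i j → ¬ Beats m j i
beats-asym (_ , inj₁ refl) (j<sink , _) = <-irrefl refl j<sink
beats-asym (i<sink , inj₂ _) (_ , inj₁ refl) = <-irrefl refl i<sink
beats-asym (_ , inj₂ (_ , ij)) (_ , inj₂ (_ , ji)) = arc-asym ij ji

beats-total : ∀ {m i j} → i ≢ j → i ≤ sink m → j ≤ sink m → Beats m i j ⊎ Beats m j i
beats-total {m} {i} {j} i≢j i≤sink j≤sink with i ≟ sink m | j ≟ sink m
... | yes refl | _ = inj₂ (≤∧≢⇒< j≤sink (i≢j ∘ sym) , inj₁ refl)
... | no _ | yes refl = inj₁ (≤∧≢⇒< i≤sink i≢j , inj₁ refl)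
... | no i≢sink | no j≢sink =
  Sum.map (λ ij → i<sink , inj₂ (j<sink , ij)) (λ ji → j<sink , inj₂ (i<sink , ji)) (arc-total i≢j)
  where
  i<sink = ≤∧≢⇒< i≤sink i≢sink
  j<sink = ≤∧≢⇒< j≤sink j≢sink

outdegree : ℕ → ℕ → ℕ
outdegree m i = count (beats? m i) 0 (suc (sink m))

m<sink : ∀ m → m < sink m
m<sink m = m<m+n m z<s

beats-sink : ∀ {m i} → i < sink m → Beats m i (sink m)
beats-sink i<sink = i<sink , inj₁ refl

-- i ≤ m: i beats exactly i+1, …, i+m and the sink.
outdegree-low : ∀ i s → outdegree (i + s) i ≡ suc (i + s)
outdegree-low i s = begin
  count P? 0 (suc (sink m))
    ≡⟨ cong (count P? 0) length≡ ⟩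
  count P? 0 (suc i + m + s + 1)
    ≡⟨ count-split₄ P? (suc i) m s 1 ⟩
  count P? 0 (suc i) + count P? (suc i) m + count P? (suc i + m) s + count P? (suc i + m + s) 1
    ≡⟨ cong₂ _+_ (cong₂ _+_ (cong₂ _+_ below ahead) above) last ⟩
  0 + m + 0 + 1
    ≡⟨ +-comm (m + 0) 1 ⟩
  suc (m + 0)
    ≡⟨ cong suc (+-identityʳ m) ⟩
  suc m
    ∎
  where
  open ≡-Reasoning
  m = i + s
  P? = beats? m i
  i≤m : i ≤ m
  i≤m = m≤m+n i s
  i<sink : i < sink m
  i<sink = ≤-<-trans i≤m (m<sink m)
  length≡ : suc ((i + s) + suc (i + s)) ≡ suc i + (i + s) + s + 1
  length≡ = solve (i ∷ s ∷ [])
  ≡sink : suc i + (i + s) + s ≡ (i + s) + suc (i + s)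
  ≡sink = solve (i ∷ s ∷ [])
  below : count P? 0 (suc i) ≡ 0
  below = count-none P? 0 (suc i) λ where
    _ (s≤s j≤i) (_ , inj₁ refl) → <-irrefl refl (≤-<-trans (≤-trans j≤i i≤m) (m<sink m))
    _ (s≤s j≤i) (_ , inj₂ (_ , inj₁ (i<j , _))) → <⇒≱ i<j j≤i
    {j} _ _ (_ , inj₂ (_ , inj₂ j+m<i)) → <⇒≱ j+m<i (≤-trans i≤m (m≤n+m m j))
  ahead : count P? (suc i) m ≡ m
  ahead = count-all P? (suc i) m λ i<j j≤i+m →
    i<sink , inj₂ (<-≤-trans j≤i+m (subst (suc i + m ≤_) ≡sink (m≤m+n _ s)) , inj₁ (i<j , ≤-pred j≤i+m))
  above : count P? (suc i + m) s ≡ 0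
  above = count-none P? (suc i + m) s λ where
    _ j<end (_ , inj₁ refl) → <-irrefl (sym ≡sink) j<end
    i+m<j _ (_ , inj₂ (_ , inj₁ (_ , j≤i+m))) → <⇒≱ i+m<j j≤i+m
    {j} i+m<j _ (_ , inj₂ (_ , inj₂ j+m<i)) →
      <-asym j+m<i (≤-<-trans (m≤m+n i m) (<-≤-trans i+m<j (m≤m+n j m)))
  last : count P? (suc i + m + s) 1 ≡ 1
  last = count-one P? (i<sink , inj₁ ≡sink)

-- m < i: i beats exactly 0, …, i−m−1 (wrapping around), i+1, …, 2m and the sink.
outdegree-high : ∀ r s → outdegree (suc r + s) (suc (suc r + s) + r) ≡ suc (suc r + s)
outdegree-high r s = begin
  count P? 0 (suc (sink m))
    ≡⟨ cong (count P? 0) length≡ ⟩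
  count P? 0 (suc r + suc m + s + 1)
    ≡⟨ count-split₄ P? (suc r) (suc m) s 1 ⟩
  count P? 0 (suc r) + count P? (suc r) (suc m) + count P? (suc r + suc m) s + count P? (suc r + suc m + s) 1
    ≡⟨ cong₂ _+_ (cong₂ _+_ (cong₂ _+_ wrapped middle) above) last ⟩
  suc r + 0 + s + 1
    ≡⟨ total≡ ⟩
  suc m
    ∎
  where
  open ≡-Reasoning
  m = suc r + s
  i = suc m + r
  P? = beats? m i
  length≡ : suc ((suc r + s) + suc (suc r + s)) ≡ suc r + suc (suc r + s) + s + 1
  length≡ = solve (r ∷ s ∷ [])
  ≡sink : suc r + suc (suc r + s) + s ≡ (suc r + s) + suc (suc r + s)
  ≡sink = solve (r ∷ s ∷ [])
  sink≡ : (suc r + s) + suc (suc r + s) ≡ suc (suc r + s) + r + suc s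
  sink≡ = solve (r ∷ s ∷ [])
  i+m≡ : suc (suc r + s) + r + (suc r + s) ≡ (suc r + s) + suc (suc r + s) + r
  i+m≡ = solve (r ∷ s ∷ [])
  suc-i≡ : suc (suc (suc r + s) + r) ≡ suc r + suc (suc r + s)
  suc-i≡ = solve (r ∷ s ∷ [])
  total≡ : suc r + 0 + s + 1 ≡ suc (suc r + s)
  total≡ = solve (r ∷ s ∷ [])
  i<sink : i < sink m
  i<sink = subst (i <_) (sym sink≡) (m<m+n i z<s)
  wrapped : count P? 0 (suc r) ≡ suc r
  wrapped = count-all P? 0 (suc r) λ {j} _ j≤r →
    let j+m<i = s≤s (subst (j + m ≤_) (+-comm r m) (+-monoˡ-≤ m (≤-pred j≤r))) in
    i<sink , inj₂ (≤-<-trans (m≤m+n j m) (<-trans j+m<i i<sink) , inj₂ j+m<i)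
  middle : count P? (suc r) (suc m) ≡ 0
  middle = count-none P? (suc r) (suc m) λ where
    _ j≤i (_ , inj₁ refl) → <⇒≱ i<sink (≤-pred (subst (sink m <_) (sym suc-i≡) j≤i))
    {j} _ j≤i (_ , inj₂ (_ , inj₁ (i<j , _))) → <⇒≱ i<j (≤-pred (subst (j <_) (sym suc-i≡) j≤i))
    {j} r<j _ (_ , inj₂ (_ , inj₂ j+m<i)) →
      <⇒≱ j+m<i (subst (_≤ j + m) (cong suc (+-comm r m)) (+-monoˡ-≤ m r<j))
  above : count P? (suc r + suc m) s ≡ s
  above = count-all P? (suc r + suc m) s λ {j} i<j j<end →
    let j<sink = subst (j <_) ≡sink j<end
        j≤i+m = <⇒≤ (<-≤-trans j<sink (subst (sink m ≤_) (sym i+m≡) (m≤m+n _ r)))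
    in i<sink , inj₂ (j<sink , inj₁ (subst (_≤ j) (sym suc-i≡) i<j , j≤i+m))
  last : count P? (suc r + suc m + s) 1 ≡ 1
  last = count-one P? (i<sink , inj₁ ≡sink)

outdegree-regular : ∀ m i → i < sink m → outdegree m i ≡ suc m
outdegree-regular m i i<sink with i ≤? m
... | yes i≤m with m≤n⇒∃[o]m+o≡n i≤m
...   | s , refl = outdegree-low i s
outdegree-regular m i i<sink | no i≰m with m≤n⇒∃[o]m+o≡n (≰⇒> i≰m)
...   | r , refl with m≤n⇒∃[o]m+o≡n (+-cancelˡ-< (suc m) r m (subst (suc m + r <_) (+-suc m m) i<sink))
...     | s , refl = outdegree-high r s

threshold : ℕ → ℕ → Fin 2
threshold e j with j <? e
... | yes _ = Fin.zero
... | no _ = Fin.suc Fin.zero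

threshold-below : ∀ {e j} → j < e → threshold e j ≡ Fin.zero
threshold-below {e} {j} j<e with j <? e
... | yes _ = refl
... | no j≮e = ⊥-elim (j≮e j<e)

threshold-above : ∀ {e j} → e ≤ j → threshold e j ≡ Fin.suc Fin.zero
threshold-above {e} {j} e≤j with j <? e
... | yes j<e = ⊥-elim (<⇒≱ j<e e≤j)
... | no _ = refl

halves : ∀ e → Fin (e + e) → Fin 2
halves e = threshold e ∘ toℕ

classSize-halves : ∀ e i → classSize (halves e) i ≡ e
classSize-halves e i = begin
  classSize (halves e) i                        ≡⟨ length-filter-allFin (inClass i) (e + e) ⟩
  count (inClass i) 0 (e + e)                   ≡⟨ count-+ (inClass i) 0 e e ⟩
  count (inClass i) 0 e + count (inClass i) e e ≡⟨ sizes i ⟩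
  e                                             ∎
  where
  open ≡-Reasoning
  inClass : ∀ i j → Dec (threshold e j ≡ i)
  inClass i j = threshold e j ≟ᶠ i
  sizes : ∀ i → count (inClass i) 0 e + count (inClass i) e e ≡ e
  sizes Fin.zero = trans
    (cong₂ _+_ (count-all _ 0 e λ _ j<e → threshold-below j<e)
               (count-none _ e e λ e≤j _ t≡0 → zero≢suc (trans (sym t≡0) (threshold-above e≤j))))
    (+-identityʳ e)
  sizes (Fin.suc Fin.zero) =
    cong₂ _+_ (count-none _ 0 e λ _ j<e t≡1 → zero≢suc (trans (sym (threshold-below j<e)) t≡1))
              (count-all _ e e λ e≤j _ → threshold-above e≤j)

module RotationalStarSystem (m : ℕ) where

  Vertex : Set
  Vertex = Fin (suc m + suc m)

  beatsᶠ? : ∀ (u v : Vertex) → Dec (Beats m (toℕ u) (toℕ v))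
  beatsᶠ? u v = beats? m (toℕ u) (toℕ v)

  open Orientation beatsᶠ? beats-asym

  sinkᶠ : Vertex
  sinkᶠ = fromℕ (sink m)

  centres : List Vertex
  centres = filter (λ c → toℕ c <? sink m) (allFin _)

  stars : List (Star (suc m + suc m))
  stars = map outStar centres

  ∈-centres⁺ : ∀ {c} → toℕ c < sink m → c ∈ centres
  ∈-centres⁺ = ∈-filter⁺ (λ c → toℕ c <? sink m) (∈-allFin _)

  ∈-centres⁻ : ∀ {c} → c ∈ centres → toℕ c < sink m
  ∈-centres⁻ = proj₂ ∘ ∈-filter⁻ (λ c → toℕ c <? sink m) {xs = allFin _}

  isStarSystem : IsStarSystem (suc m) (suc m + suc m) stars
  isStarSystem = outStars-isStarSystem centres-unique (∈-centres⁺ ∘ proj₁) total regular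
    where
    centres-unique : Unique centres
    centres-unique = Unique.filter⁺ (λ c → toℕ c <? sink m) (Unique.allFin⁺ _)
    total : ∀ {u v} → u ≢ v → Beats m (toℕ u) (toℕ v) ⊎ Beats m (toℕ v) (toℕ u)
    total {u} {v} u≢v = beats-total (u≢v ∘ toℕ-injective) (≤-pred (toℕ<n u)) (≤-pred (toℕ<n v))
    regular : ∀ {c} → c ∈ centres → length (outNeighbours c) ≡ suc m
    regular {c} c∈ =
      trans (length-filter-allFin (beats? m (toℕ c)) _) (outdegree-regular m (toℕ c) (∈-centres⁻ c∈))

  halves-proper : ProperColouring stars (halves (suc m))
  halves-proper = All.map⁺ (All.tabulate λ c∈ → proper (∈-centres⁻ c∈))
    where
    proper : ∀ {c} → toℕ c < sink m → ¬ Monochromatic (halves (suc m)) (outStar c)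
    proper {c} c<sink with toℕ c ≤? m
    ... | yes c≤m = outStar-not-monochromatic (halves (suc m)) {v = sinkᶠ}
      (subst (Beats m (toℕ c)) (sym (toℕ-fromℕ (sink m))) (beats-sink c<sink))
      λ colours≡ → zero≢suc (trans (sym (trans colours≡ (threshold-below (s≤s c≤m))))
                                   (threshold-above (subst (suc m ≤_) (sym (toℕ-fromℕ (sink m))) (m<sink m))))
    ... | no c≰m = outStar-not-monochromatic (halves (suc m)) {v = Fin.zero}
      (c<sink , inj₂ (≤-<-trans z≤n c<sink , inj₂ (≰⇒> c≰m)))
      λ colours≡ → zero≢suc (trans colours≡ (threshold-above (≰⇒> c≰m)))

  chromatic : Chromatic 2 stars
  chromatic = colourable-2⇒chromatic-2 (∈-map⁺ outStar (∈-centres⁺ {Fin.zero} (≤-<-trans z≤n (m<sink m))))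
                                       (halves (suc m) , halves-proper)

theorem3p1 : (e : ℕ) → 3 ≤ e →
    Σ (List (Star (e + e))) λ B →
      IsStarSystem e (e + e) B × Chromatic 2 B ×
      Σ (Fin (e + e) → Fin 2) λ col →
        ProperColouring B col × (∀ (i : Fin 2) → classSize col i ≡ e)
-- The construction works for every e ≥ 1; the hypothesis only rules out e = 0.
theorem3p1 zero ()
theorem3p1 (suc m) _ =
  stars , isStarSystem , chromatic , halves (suc m) , halves-proper , classSize-halves (suc m)
  where open RotationalStarSystem m
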